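{- Let $D$ be a digraph of order $p\geq 4$, and let $P:=x_1x_2\ldots x_m$, $m\in[2,p-2]$, be a longest path from $x_1$ to $x_m$ in $D$ (i.e., no path from $x_1$ to $x_m$ in $D$ has more vertices than $P$). Suppose that the induced subdigraph $D\langle V(D)\setminus V(P)\rangle$ is strongly connected and that $d(x,V(P))=m+1$ for every vertex $x\in V(D)\setminus V(P)$. Then there is an integer $l\in[1,m]$ such that for every $x\in V(D)\setminus V(P)$, $$O(x,V(P))=\{x_1,x_2,\ldots,x_l\}\quad\text{and}\quad I(x,V(P))=\{x_l,x_{l+1},\ldots,x_m\}.$$
   Context: Digraphs are finite, without loops or multiple arcs; paths are simple and directed. For a vertex $x$ and a set $S$ of vertices, $O(x,S)=\{y\in S: xy\in E(D)\}$, $I(x,S)=\{y\in S: yx\in E(D)\}$, and $d(x,S)=|O(x,S)|+|I(x,S)|$. $D\langle S\rangle$ denotes the subdigraph induced by $S$. -}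

module Defs where

open import Data.Nat using (ℕ; zero; suc; _+_; _≤_; _<_)
open import Data.Bool using (Bool; true; false)
open import Data.Fin using (Fin; toℕ)
open import Data.List using (List; []; _∷_; length; head; last; map)
open import Data.Nat.ListAction using (sum)
open import Data.List.Membership.Propositional using (_∈_; _∉_)
open import Data.List.Relation.Unary.Unique.Propositional using (Unique)
open import Data.List.Relation.Unary.All using (All)
open import Data.Maybe using (Maybe; just)
open import Data.Vec.Functional using (Vector)
open import Data.Product using (_×_; Σ; ∃)
open import Relation.Binary.PropositionalEquality using (_≡_; _≢_)
open import Function using (_∘_)

-- A digraph on the vertex set Fin p, given by its (Boolean) arc relation;
-- no loops. Multiple arcs are impossible in this representation.
record Digraph (p : ℕ) : Set where
  field
    arc    : Fin p → Fin p → Bool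
    noLoop : ∀ v → arc v v ≡ false
open Digraph public

Walk : ∀ {p} → Digraph p → List (Fin p) → Set
Walk D []           = Data.Unit.⊤ where import Data.Unit
Walk D (u ∷ [])     = Data.Unit.⊤ where import Data.Unit
Walk D (u ∷ v ∷ vs) = (arc D u v ≡ true) × Walk D (v ∷ vs)

IsPath : ∀ {p} → Digraph p → List (Fin p) → Set
IsPath D vs = Unique vs × Walk D vs

PathFromTo : ∀ {p} → Digraph p → Fin p → Fin p → List (Fin p) → Set
PathFromTo D a b vs = IsPath D vs × (head vs ≡ just a) × (last vs ≡ just b)

toList : ∀ {A : Set} {m} → Vector A m → List A
toList {m = zero}  f = []
toList {m = suc m} f = f Fin.zero ∷ toList (f ∘ Fin.suc)
  where import Data.Fin as Fin

ind : Bool → ℕ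
ind true  = 1
ind false = 0

-- |O(x,S)| for S given as a duplicate-free list
outDeg : ∀ {p} → Digraph p → Fin p → List (Fin p) → ℕ
outDeg D x S = sum (map (λ y → ind (arc D x y)) S)

inDeg : ∀ {p} → Digraph p → Fin p → List (Fin p) → ℕ
inDeg D x S = sum (map (λ y → ind (arc D y x)) S)

deg : ∀ {p} → Digraph p → Fin p → List (Fin p) → ℕ
deg D x S = outDeg D x S + inDeg D x S

-- D⟨V(D) ∖ S⟩ is strongly connected: any two vertices outside S are joined
-- by a path of D all of whose vertices lie outside S.
StronglyConnectedOutside : ∀ {p} → Digraph p → List (Fin p) → Set
StronglyConnectedOutside D S =
  ∀ u v → u ∉ S → v ∉ S →
    Σ (List _) λ vs → PathFromTo D u v vs × All (_∉ S) vs

-- Replacing the part of L strictly between x_i and x_j by a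
--    path through fresh vertices gives another x₀–x_{m-1} path, so such a
--    detour has at most j - i - 1 vertices.  With one fresh vertex y this
--    forbids x_i → y → x_{i+1}; with two it forbids x_i → y → z → x_j, j ≤ i+2.
--  * Counting.  Write the m + 1 arcs between y and L as the m + 1 terms
--    [y→x₀], [x_{m-1}→y] and [x_i→y] + [y→x_{i+1}] (i < m-1), each at most 1.
--    Hence y → x₀, x_{m-1} → y and x_i → y holds exactly when y ↛ x_{i+1}.
--  * Propagation.  If y → z outside L, every out-neighbour x_k of z, and the
--    predecessor x_{k-1} of every out-neighbour x_k of z, is an out-neighbour
--    of y.  By strong connectivity all outside vertices then have the same
--    out-neighbours on L, and these form an initial segment x₀ … x_{l-1}.
--  * The counting step turns this threshold for out-arcs into the threshold
--    x_{l-1} … x_{m-1} for in-arcs, which is the theorem.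
module Submission where

open import Defs
open import Data.Nat using (ℕ; zero; suc; _+_; _≤_; _<_; _∸_; z≤n; s≤s; s≤s⁻¹)
open import Data.Nat.Properties
  using (≤-refl; ≤-trans; ≤-reflexive; ≤-antisym; <⇒≱; ≮⇒≥; <-irrefl; n≤1+n;
         m≤n⇒m<n∨m≡n; +-comm; +-mono-≤; +-monoʳ-≤; +-monoˡ-≤; +-cancelˡ-≤; +-cancelʳ-≤; m∸n+n≡m)
open import Data.Nat.ListAction using (sum)
open import Data.Nat.Tactic.RingSolver using (solve-∀)
open import Data.Bool using (Bool; true; false; not)
open import Data.Fin using (Fin; toℕ)
import Data.Fin as Fin
open import Data.Fin.Properties using (toℕ<n; pigeonhole; ¬∀⟶∃¬) renaming (<-irrefl to <ᶠ-irrefl)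
open import Data.List using (List; []; _∷_; _++_; [_]; length; head; last; map; applyUpTo)
open import Data.List.Properties using (length-++; length-applyUpTo; map-applyUpTo)
open import Data.List.Membership.Propositional using (_∈_; _∉_)
open import Data.List.Membership.Propositional.Properties using (∈-++⁺ˡ; ∈-++⁺ʳ; ∈-++⁻)
open import Data.List.Membership.Setoid.Properties using (index-injective)
open import Data.List.Relation.Unary.All as All using (All; []; _∷_)
open import Data.List.Relation.Unary.All.Properties using (applyUpTo⁺₁; applyUpTo⁻)
open import Data.List.Relation.Unary.Any using (here; there; index; any?)
open import Data.List.Relation.Unary.AllPairs using ([]; _∷_)
open import Data.List.Relation.Unary.Unique.Propositional using (Unique)
open import Data.List.Relation.Unary.Unique.Propositional.Properties using (++⁺)
open import Data.Maybe using (just)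
open import Data.Vec.Functional using (Vector)
open import Data.Product using (_×_; Σ; ∃; _,_; proj₁; proj₂)
open import Data.Sum using (inj₁; inj₂)
open import Data.Empty using (⊥; ⊥-elim)
open import Function using (_∘_)
open import Data.Unit using (tt)
open import Function.Bundles using (_⇔_; mk⇔; Equivalence)
open import Relation.Nullary using (¬_)
open import Relation.Binary.PropositionalEquality
  using (_≡_; _≢_; refl; sym; trans; cong; cong₂; subst; subst₂; setoid; module ≡-Reasoning)

open Equivalence using (to; from)

nth : ∀ {A : Set} → A → List A → ℕ → A
nth d []       k       = d
nth d (u ∷ us) zero    = u
nth d (u ∷ us) (suc k) = nth d us k

-- A list is the tabulation of its entries; this turns sums over a path
-- into sums over positions.
applyUpTo-nth : ∀ {A : Set} (d : A) (L : List A) → applyUpTo (nth d L) (length L) ≡ L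
applyUpTo-nth d []       = refl
applyUpTo-nth d (u ∷ us) = cong (u ∷_) (applyUpTo-nth d us)

nth-toList : ∀ {A : Set} {m} (P : Vector A m) (d : A) (i : Fin m) →
             nth d (toList P) (toℕ i) ≡ P i
nth-toList P d Fin.zero    = refl
nth-toList P d (Fin.suc i) = nth-toList (P ∘ Fin.suc) d i

length-toList : ∀ {A : Set} {m} (P : Vector A m) → length (toList P) ≡ m
length-toList {m = zero}  P = refl
length-toList {m = suc m} P = cong suc (length-toList (P ∘ Fin.suc))

split-at : ∀ {A : Set} (d : A) (L : List A) j → j < length L →
  Σ (List A) λ mid → Σ (List A) λ post → (L ≡ mid ++ nth d L j ∷ post) × (length mid ≡ j)
split-at d (u ∷ us) zero    _         = [] , us , refl , refl
split-at d (u ∷ us) (suc j) (s≤s j<) with split-at d us j j<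
... | mid , post , eq , len = u ∷ mid , post , cong (u ∷_) eq , cong suc len

split-between : ∀ {A : Set} (d : A) (L : List A) i j → i < j → j < length L →
  Σ (List A) λ pre → Σ (List A) λ mid → Σ (List A) λ post →
    (L ≡ pre ++ nth d L i ∷ mid ++ nth d L j ∷ post) × (suc (i + length mid) ≡ j)
split-between d (u ∷ us) zero (suc j) _ (s≤s j<) with split-at d us j j<
... | mid , post , eq , len = [] , mid , post , cong (u ∷_) eq , cong suc len
split-between d (u ∷ us) (suc i) (suc j) (s≤s i<j) (s≤s j<) with split-between d us i j i<j j<
... | pre , mid , post , eq , len = u ∷ pre , mid , post , cong (u ∷_) eq , cong suc len

head-++-∷ : ∀ {A : Set} (xs : List A) {y ys zs} → head (xs ++ y ∷ ys) ≡ head (xs ++ y ∷ zs)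
head-++-∷ []       = refl
head-++-∷ (x ∷ xs) = refl

last-++-∷ : ∀ {A : Set} (xs : List A) {y ys} → last (xs ++ y ∷ ys) ≡ last (y ∷ ys)
last-++-∷ []           = refl
last-++-∷ (x ∷ [])     = refl
last-++-∷ (x ∷ x′ ∷ xs) = last-++-∷ (x′ ∷ xs)

length-detour : ∀ {A : Set} (pre : List A) u X B →
                length (pre ++ u ∷ X ++ B) ≡ length pre + suc (length X + length B)
length-detour pre u X B
  rewrite length-++ pre {u ∷ X ++ B} | length-++ X {B} = refl

unique-drop : ∀ {A : Set} (xs : List A) {ys} → Unique (xs ++ ys) → Unique ys
unique-drop []       u       = u
unique-drop (x ∷ xs) (_ ∷ u) = unique-drop xs u

unique-replace : ∀ {A : Set} (xs : List A) {ys zs} → Unique (xs ++ ys) → Unique zs →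
                 (∀ {z} → z ∈ xs → z ∈ zs → z ∈ ys) → Unique (xs ++ zs)
unique-replace []       _        uz _ = uz
unique-replace (x ∷ xs) {zs = zs} (x∉ ∷ u) uz meet =
  All.tabulate x≢ ∷ unique-replace xs u uz (meet ∘ there)
  where
  x≢ : ∀ {z} → z ∈ xs ++ zs → x ≢ z
  x≢ z∈ with ∈-++⁻ xs z∈
  ... | inj₁ z∈xs = All.lookup x∉ (∈-++⁺ˡ z∈xs)
  ... | inj₂ z∈zs = λ x≡z → All.lookup x∉ (∈-++⁺ʳ xs (meet (here (sym x≡z)) z∈zs)) x≡z

missing-vertex : ∀ {p} (K : List (Fin p)) → length K < p → ∃ λ v → v ∉ K
missing-vertex {p} K short = ¬∀⟶∃¬ p (_∈ K) (λ v → any? (v Fin.≟_) K) not-all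
  where
  not-all : ¬ (∀ v → v ∈ K)
  not-all every with pigeonhole short (λ v → index (every v))
  ... | i , j , i<j , same =
    <ᶠ-irrefl (index-injective (setoid _) (every i) (every j) same) i<j

bounds-attained : ∀ {x y a b} → x ≤ a → y ≤ b → a + b ≤ x + y → (x ≡ a) × (y ≡ b)
bounds-attained {x} {y} {a} {b} x≤a y≤b sum≥ =
  ≤-antisym x≤a (+-cancelʳ-≤ b a x (≤-trans sum≥ (+-monoʳ-≤ x y≤b))) ,
  ≤-antisym y≤b (+-cancelˡ-≤ a b y (≤-trans sum≥ (+-monoˡ-≤ y x≤a)))

sum-bits-≤ : (xs : List ℕ) → All (_≤ 1) xs → sum xs ≤ length xs
sum-bits-≤ []       []         = z≤n
sum-bits-≤ (x ∷ xs) (x≤ ∷ xs≤) = +-mono-≤ x≤ (sum-bits-≤ xs xs≤)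

bits-saturated : (xs : List ℕ) → All (_≤ 1) xs → length xs ≤ sum xs → All (_≡ 1) xs
bits-saturated []       []         _    = []
bits-saturated (x ∷ xs) (x≤ ∷ xs≤) full
  with bounds-attained x≤ (sum-bits-≤ xs xs≤) full
... | x≡1 , sum≡ = x≡1 ∷ bits-saturated xs xs≤ (≤-reflexive (sym sum≡))

sum-interleave : ∀ n (f g : ℕ → ℕ) →
  sum (applyUpTo f (suc n)) + sum (applyUpTo g (suc n)) ≡
  f 0 + (g n + sum (applyUpTo (λ i → g i + f (suc i)) n))
sum-interleave zero    f g = regroup₀ (f 0) (g 0)
  where
  regroup₀ : ∀ a b → (a + 0) + (b + 0) ≡ a + (b + 0)
  regroup₀ = solve-∀
sum-interleave (suc n) f g = begin
  (f 0 + F) + (g 0 + G)                       ≡⟨ regroup (f 0) (g 0) F G ⟩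
  f 0 + (g 0 + (F + G))                       ≡⟨ cong (λ t → f 0 + (g 0 + t)) (sum-interleave n (f ∘ suc) (g ∘ suc)) ⟩
  f 0 + (g 0 + (f 1 + (g (suc n) + S)))       ≡⟨ regroup′ (f 0) (g 0) (f 1) (g (suc n)) S ⟩
  f 0 + (g (suc n) + ((g 0 + f 1) + S))       ∎
  where
  open ≡-Reasoning
  F G S : ℕ
  F = sum (applyUpTo (f ∘ suc) (suc n))
  G = sum (applyUpTo (g ∘ suc) (suc n))
  S = sum (applyUpTo (λ i → g (suc i) + f (suc (suc i))) n)
  regroup : ∀ a b c d → (a + c) + (b + d) ≡ a + (b + (c + d))
  regroup = solve-∀
  regroup′ : ∀ a b c d e → a + (b + (c + (d + e))) ≡ a + (d + ((b + c) + e))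
  regroup′ = solve-∀

true≢false : true ≢ false
true≢false ()

ind-≤1 : ∀ β → ind β ≤ 1
ind-≤1 true  = s≤s z≤n
ind-≤1 false = z≤n

ind≡1 : ∀ {β} → ind β ≡ 1 → β ≡ true
ind≡1 {true} _ = refl

at-most-one : ∀ β α → (β ≡ true → α ≡ true → ⊥) → ind β + ind α ≤ 1
at-most-one true  true  both = ⊥-elim (both refl refl)
at-most-one true  false _    = s≤s z≤n
at-most-one false α     _    = ind-≤1 α

exactly-one : ∀ β α → ind β + ind α ≡ 1 → β ≡ not α
exactly-one true  false _ = refl
exactly-one false true  _ = refl

bool-≡ : ∀ {β α} → (β ≡ true → α ≡ true) → (α ≡ true → β ≡ true) → β ≡ α
bool-≡ {true}  {true}  _  _  = refl
bool-≡ {false} {false} _  _  = refl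
bool-≡ {true}  {false} βα _  = ⊥-elim (true≢false (sym (βα refl)))
bool-≡ {false} {true}  _  αβ = ⊥-elim (true≢false (sym (αβ refl)))

count : (ℕ → Bool) → ℕ → ℕ
count f n = sum (applyUpTo (λ k → ind (f k)) n)

alternation : ∀ n (a b : ℕ → Bool) →
  (∀ i → i < n → b i ≡ true → a (suc i) ≡ true → ⊥) →
  suc (suc n) ≤ count a (suc n) + count b (suc n) →
  (a 0 ≡ true) × (b n ≡ true) × (∀ i → i < n → b i ≡ not (a (suc i)))
alternation n a b exclusive total with bits-saturated tally bounded saturated
  where
  pair : ℕ → ℕ
  pair i = ind (b i) + ind (a (suc i))
  tally : List ℕ
  tally = ind (a 0) ∷ ind (b n) ∷ applyUpTo pair n
  bounded : All (_≤ 1) tally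
  bounded = ind-≤1 (a 0) ∷ ind-≤1 (b n) ∷
            applyUpTo⁺₁ pair n (λ {i} i<n → at-most-one (b i) (a (suc i)) (exclusive i i<n))
  length-tally : length tally ≡ suc (suc n)
  length-tally = cong (suc ∘ suc) (length-applyUpTo pair n)
  regrouped : count a (suc n) + count b (suc n) ≡ sum tally
  regrouped = sum-interleave n (λ k → ind (a k)) (λ k → ind (b k))
  saturated : length tally ≤ sum tally
  saturated = subst₂ _≤_ (sym length-tally) regrouped total
... | a₀ ∷ bₙ ∷ pairs =
  ind≡1 a₀ , ind≡1 bₙ , λ i i<n → exactly-one (b i) (a (suc i)) (applyUpTo⁻ _ n pairs i<n)

threshold : ∀ n (f : ℕ → Bool) → (∀ k → suc k < n → f (suc k) ≡ true → f k ≡ true) →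
            Σ ℕ λ l → (l ≤ n) × (∀ k → k < n → (f k ≡ true ⇔ k < l))
threshold zero    f closed = 0 , z≤n , λ k ()
threshold (suc n) f closed
  with threshold n (f ∘ suc) (λ k k<n → closed (suc k) (s≤s k<n)) | f 0 in f₀
... | l , l≤n , spec | true = suc l , s≤s l≤n , spec′
  where
  spec′ : ∀ k → k < suc n → (f k ≡ true ⇔ k < suc l)
  spec′ zero    _          = mk⇔ (λ _ → s≤s z≤n) (λ _ → f₀)
  spec′ (suc k) (s≤s k<n) = mk⇔ (s≤s ∘ to (spec k k<n)) (from (spec k k<n) ∘ s≤s⁻¹)
... | l , l≤n , spec | false = 0 , z≤n , spec′
  where
  -- were f (k+1) true for some k, then f 1 and, by closure, f 0 would hold
  no-run : ∀ k → k < n → f (suc k) ≡ true → ⊥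
  no-run k k<n fk = true≢false (trans (sym f0) f₀)
    where
    0<n : 0 < n
    0<n = ≤-trans (s≤s z≤n) k<n
    f0 : f 0 ≡ true
    f0 = closed 0 (s≤s 0<n) (from (spec 0 0<n) (≤-trans (s≤s z≤n) (to (spec k k<n) fk)))
  spec′ : ∀ k → k < suc n → (f k ≡ true ⇔ k < 0)
  spec′ zero    _          = mk⇔ (λ f0 → ⊥-elim (true≢false (trans (sym f0) f₀))) (λ ())
  spec′ (suc k) (s≤s k<n) = mk⇔ (λ fk → ⊥-elim (no-run k k<n fk)) (λ ())

negate-threshold : ∀ {β k l} → (β ≡ true ⇔ k < l) → (not β ≡ true ⇔ l ≤ k)
negate-threshold {true}  spec = mk⇔ (λ ()) (λ l≤k → ⊥-elim (<⇒≱ (to spec refl) l≤k))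
negate-threshold {false} spec = mk⇔ (λ _ → ≮⇒≥ (λ k<l → true≢false (sym (from spec k<l)))) (λ _ → refl)

module _ {p} (D : Digraph p) where

  Longest : List (Fin p) → Set
  Longest L = ∀ N → IsPath D N → head N ≡ head L → last N ≡ last L → length N ≤ length L

  walk-++⁻ : ∀ xs {y ys} → Walk D (xs ++ y ∷ ys) → Walk D (xs ++ [ y ]) × Walk D (y ∷ ys)
  walk-++⁻ []            w       = tt , w
  walk-++⁻ (x ∷ [])      (a , w) = (a , tt) , w
  walk-++⁻ (x ∷ x′ ∷ xs) (a , w) with walk-++⁻ (x′ ∷ xs) w
  ... | w₁ , w₂ = (a , w₁) , w₂

  walk-++⁺ : ∀ xs {y ys} → Walk D (xs ++ [ y ]) → Walk D (y ∷ ys) → Walk D (xs ++ y ∷ ys)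
  walk-++⁺ []            _        w = w
  walk-++⁺ (x ∷ [])      (a , _)  w = a , w
  walk-++⁺ (x ∷ x′ ∷ xs) (a , w₁) w = a , walk-++⁺ (x′ ∷ xs) w₁ w

  arc-distinct : ∀ {y z} → arc D y z ≡ true → y ≢ z
  arc-distinct {y} yz refl = true≢false (trans (sym yz) (noLoop D y))

  -- In a longest path pre ++ u ∷ mid ++ w ∷ post, a u–w detour through
  -- vertices off the path has no more inner vertices than mid: otherwise
  -- pre ++ u ∷ Q ++ w ∷ post would be a longer path with the same ends.
  no-long-detour : ∀ pre u mid w post →
    IsPath D (pre ++ u ∷ mid ++ w ∷ post) → Longest (pre ++ u ∷ mid ++ w ∷ post) →
    (Q : List (Fin p)) → Unique Q → All (_∉ pre ++ u ∷ mid ++ w ∷ post) Q →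
    Walk D (u ∷ Q ++ [ w ]) → length Q ≤ length mid
  no-long-detour pre u mid w post (uniqL , walkL) longest Q uniqQ fresh walkQ =
    +-cancelʳ-≤ (length B) (length Q) (length mid)
      (s≤s⁻¹ (+-cancelˡ-≤ (length pre) _ _ longer))
    where
    B L N : List (Fin p)
    B = w ∷ post
    L = pre ++ u ∷ mid ++ B
    N = pre ++ u ∷ Q ++ B

    off-path : ∀ {z} → z ∈ Q → z ∈ L → ⊥
    off-path = All.lookup fresh

    walkN : Walk D N
    walkN = walk-++⁺ pre (proj₁ (walk-++⁻ pre walkL))
              (walk-++⁺ (u ∷ Q) walkQ (proj₂ (walk-++⁻ (u ∷ mid) (proj₂ (walk-++⁻ pre walkL)))))

    uniqQB : Unique (Q ++ B)
    uniqQB = ++⁺ uniqQ (unique-drop (u ∷ mid) (unique-drop pre uniqL))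
               (λ (z∈Q , z∈B) → off-path z∈Q (∈-++⁺ʳ pre (there (∈-++⁺ʳ mid z∈B))))

    uniq-uQB : Unique (u ∷ Q ++ B)
    uniq-uQB = unique-replace [ u ] (unique-drop pre uniqL) uniqQB meet
      where
      meet : ∀ {z} → z ∈ [ u ] → z ∈ Q ++ B → z ∈ mid ++ B
      meet (here refl) z∈ with ∈-++⁻ Q z∈
      ... | inj₁ u∈Q = ⊥-elim (off-path u∈Q (∈-++⁺ʳ pre (here refl)))
      ... | inj₂ u∈B = ∈-++⁺ʳ mid u∈B

    uniqN : Unique N
    uniqN = unique-replace pre uniqL uniq-uQB meet
      where
      meet : ∀ {z} → z ∈ pre → z ∈ u ∷ Q ++ B → z ∈ u ∷ mid ++ B
      meet _     (here z≡u) = here z≡u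
      meet z∈pre (there z∈) with ∈-++⁻ Q z∈
      ... | inj₁ z∈Q = ⊥-elim (off-path z∈Q (∈-++⁺ˡ z∈pre))
      ... | inj₂ z∈B = there (∈-++⁺ʳ mid z∈B)

    same-last : last N ≡ last L
    same-last = trans (last-++-∷ pre) (trans (last-++-∷ (u ∷ Q))
                  (sym (trans (last-++-∷ pre) (last-++-∷ (u ∷ mid)))))

    longer : length pre + suc (length Q + length B) ≤ length pre + suc (length mid + length B)
    longer = subst₂ _≤_ (length-detour pre u Q B) (length-detour pre u mid B)
               (longest N (uniqN , walkN) (head-++-∷ pre) same-last)

module OutsideLongestPath {p} (D : Digraph p) (L : List (Fin p)) (d : Fin p) (n : ℕ)
  (length-L : length L ≡ suc n) (pathL : IsPath D L) (longest : Longest D L)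
  (degree : ∀ y → y ∉ L → deg D y L ≡ suc (length L))
  (room : suc (suc (length L)) ≤ p)
  (strong : StronglyConnectedOutside D L) where

  x : ℕ → Fin p
  x = nth d L

  on-path : ∀ {j} → j ≤ n → j < length L
  on-path j≤n = subst (_ <_) (sym length-L) (s≤s j≤n)

  detour-bound : ∀ {i j} → i < j → j ≤ n → (Q : List (Fin p)) → Unique Q → All (_∉ L) Q →
                 Walk D (x i ∷ Q ++ [ x j ]) → i + length Q < j
  detour-bound {i} {j} i<j j≤n Q uniqQ fresh walkQ with split-between d L i j i<j (on-path j≤n)
  ... | pre , mid , post , split , gap =
    ≤-trans (s≤s (+-monoʳ-≤ i detour≤)) (≤-reflexive gap)
    where
    detour≤ : length Q ≤ length mid
    detour≤ = no-long-detour D pre (x i) mid (x j) post (subst (IsPath D) split pathL)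
                (subst (Longest D) split longest) Q uniqQ (subst (λ K → All (_∉ K) Q) split fresh) walkQ

  no-insertion : ∀ {y i} → y ∉ L → i < n → arc D (x i) y ≡ true → arc D y (x (suc i)) ≡ true → ⊥
  no-insertion {y} {i} y∉ i<n xy yx =
    <-irrefl (+-comm i 1) (detour-bound ≤-refl i<n [ y ] ([] ∷ []) (y∉ ∷ []) (xy , yx , tt))

  sum-over-positions : (g : Fin p → ℕ) → sum (map g L) ≡ sum (applyUpTo (g ∘ x) (suc n))
  sum-over-positions g = begin
    sum (map g L)                           ≡⟨ cong (sum ∘ map g) (sym (applyUpTo-nth d L)) ⟩
    sum (map g (applyUpTo x (length L)))    ≡⟨ cong sum (map-applyUpTo x g (length L)) ⟩
    sum (applyUpTo (g ∘ x) (length L))      ≡⟨ cong (sum ∘ applyUpTo (g ∘ x)) length-L ⟩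
    sum (applyUpTo (g ∘ x) (suc n))         ∎
    where open ≡-Reasoning

  arc-pattern : ∀ {y} → y ∉ L →
    (arc D y (x 0) ≡ true) × (arc D (x n) y ≡ true) ×
    (∀ i → i < n → arc D (x i) y ≡ not (arc D y (x (suc i))))
  arc-pattern {y} y∉ =
    alternation n (λ k → arc D y (x k)) (λ k → arc D (x k) y)
      (λ i i<n → no-insertion y∉ i<n) (≤-reflexive (sym total))
    where
    total : count (λ k → arc D y (x k)) (suc n) + count (λ k → arc D (x k) y) (suc n) ≡ suc (suc n)
    total = trans (sym (cong₂ _+_ (sum-over-positions _) (sum-over-positions _)))
                  (trans (degree y y∉) (cong suc length-L))

  -- If y → z off L, then y → x_k whenever z → x_k or z → x_{k+1}:
  -- otherwise x_{k-1} → y, and x_{k-1} → y → z → x_j is a too long detour.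
  pull-back : ∀ {y z j} k → y ∉ L → z ∉ L → arc D y z ≡ true → arc D z (x j) ≡ true →
              k ≤ j → j ≤ suc k → j ≤ n → arc D y (x k) ≡ true
  pull-back zero y∉ _ _ _ _ _ _ = proj₁ (arc-pattern y∉)
  pull-back {y} {z} {j} (suc i) y∉ z∉ yz zx k≤j j≤k+1 j≤n with arc D y (x (suc i)) in yx
  ... | true  = refl
  ... | false = ⊥-elim (<⇒≱ (subst (_< j) (+-comm i 2) too-long) j≤k+1)
    where
    xy : arc D (x i) y ≡ true
    xy = trans (proj₂ (proj₂ (arc-pattern y∉)) i (≤-trans k≤j j≤n)) (cong not yx)
    too-long : i + 2 < j
    too-long = detour-bound k≤j j≤n (y ∷ z ∷ [])
                 ((arc-distinct D yz ∷ []) ∷ [] ∷ []) (y∉ ∷ z∉ ∷ []) (xy , yz , zx , tt)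

  _⊑_ : Fin p → Fin p → Set
  z ⊑ y = ∀ k → k ≤ n → arc D z (x k) ≡ true → arc D y (x k) ≡ true

  walk-⊑ : ∀ y vs z → Walk D (y ∷ vs) → All (_∉ L) (y ∷ vs) → last (y ∷ vs) ≡ just z → z ⊑ y
  walk-⊑ y []       z _        _            refl k _   zk = zk
  walk-⊑ y (v ∷ vs) z (yv , w) (y∉ ∷ vs∉) ends   k k≤n zk =
    pull-back k y∉ (All.head vs∉) yv (walk-⊑ v vs z w vs∉ ends k k≤n zk) ≤-refl (n≤1+n k) k≤n

  -- By strong connectivity any two outside vertices are joined by a path
  -- off L, along which pull-back transports out-neighbours.
  reach-⊑ : ∀ {y z} → y ∉ L → z ∉ L → z ⊑ y
  reach-⊑ {y} {z} y∉ z∉ with strong y z y∉ z∉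
  ... | []       , ((_ , () , _) , _)
  ... | (v ∷ vs) , ((_ , w) , refl , ends) , vs∉ = walk-⊑ v vs z w vs∉ ends

  same-out-arcs : ∀ {y z} → y ∉ L → z ∉ L → ∀ k → k ≤ n → arc D y (x k) ≡ arc D z (x k)
  same-out-arcs y∉ z∉ k k≤n = bool-≡ (reach-⊑ z∉ y∉ k k≤n) (reach-⊑ y∉ z∉ k k≤n)

  -- Since at least two vertices lie off L, each has an out-neighbour off L.
  outside-successor : ∀ {y} → y ∉ L → ∃ λ z → z ∉ L × arc D y z ≡ true
  outside-successor {y} y∉ with missing-vertex (y ∷ L) room
  ... | w , w∉ with strong y w y∉ (w∉ ∘ there)
  ... | []           , ((_ , () , _) , _)
  ... | (v ∷ [])     , ((_ , refl , refl) , _) = ⊥-elim (w∉ (here refl))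
  ... | (v ∷ z ∷ vs) , ((_ , (yz , _)) , refl , _) , (_ ∷ z∉ ∷ _) = z , z∉ , yz

  -- Out-neighbours on L form an initial segment: if y → x_{k+1}, pass to an
  -- out-neighbour z of y off L, which also has z → x_{k+1}, and pull back.
  out-arcs-downward : ∀ {y} → y ∉ L → ∀ k → suc k ≤ n → arc D y (x (suc k)) ≡ true → arc D y (x k) ≡ true
  out-arcs-downward y∉ k k<n yx with outside-successor y∉
  ... | z , z∉ , yz = pull-back k y∉ z∉ yz (reach-⊑ z∉ y∉ (suc k) k<n yx) (n≤1+n k) ≤-refl k<n

  classification : Σ ℕ λ l → (1 ≤ l) × (l ≤ suc n) ×
    (∀ y → y ∉ L → ∀ i → i ≤ n → (arc D y (x i) ≡ true ⇔ i < l) × (arc D (x i) y ≡ true ⇔ l ≤ suc i))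
  classification with missing-vertex L (≤-trans (n≤1+n _) room)
  ... | y₀ , y₀∉ with threshold (suc n) (λ k → arc D y₀ (x k)) (λ k k<n → out-arcs-downward y₀∉ k (s≤s⁻¹ k<n))
  ... | l , l≤ , out₀ = l , to (out₀ 0 (s≤s z≤n)) (proj₁ (arc-pattern y₀∉)) , l≤ ,
                        λ y y∉ i i≤n → outgoing y∉ i i≤n , incoming y∉ i i≤n
    where
    outgoing : ∀ {y} → y ∉ L → ∀ i → i ≤ n → (arc D y (x i) ≡ true ⇔ i < l)
    outgoing y∉ i i≤n = subst (λ β → β ≡ true ⇔ i < l) (sym (same-out-arcs y∉ y₀∉ i i≤n)) (out₀ i (s≤s i≤n))
    incoming : ∀ {y} → y ∉ L → ∀ i → i ≤ n → (arc D (x i) y ≡ true ⇔ l ≤ suc i)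
    incoming y∉ i i≤n with m≤n⇒m<n∨m≡n i≤n
    ... | inj₁ i<n  = subst (λ β → β ≡ true ⇔ l ≤ suc i) (sym (proj₂ (proj₂ (arc-pattern y∉)) i i<n))
                        (negate-threshold (outgoing y∉ (suc i) i<n))
    ... | inj₂ refl = mk⇔ (λ _ → l≤) (λ _ → proj₁ (proj₂ (arc-pattern y∉)))

last-nonempty : ∀ {A : Set} (u : A) us → ∃ λ b → last (u ∷ us) ≡ just b
last-nonempty u []        = u , refl
last-nonempty u (u′ ∷ us) = last-nonempty u′ us

-- The theorem: P = x₀ … x_{m-1} with n = m - 1, default vertex x₀; the
-- hypotheses become those of OutsideLongestPath, whose classification
-- is read back at the positions toℕ i of P.
lemma3 : (p : ℕ) → 4 ≤ p → (D : Digraph p) →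
    (m : ℕ) → 2 ≤ m → m ≤ p ∸ 2 →
    (P : Vector (Fin p) m) →
    IsPath D (toList P) →
    ((a b : Fin p) → head (toList P) ≡ just a → last (toList P) ≡ just b →
        (vs : List (Fin p)) → PathFromTo D a b vs → length vs ≤ m) →
    StronglyConnectedOutside D (toList P) →
    (∀ x → x ∉ toList P → deg D x (toList P) ≡ m + 1) →
    Σ ℕ λ l → (1 ≤ l) × (l ≤ m) ×
      (∀ x → x ∉ toList P → (i : Fin m) →
        ((arc D x (P i) ≡ true) ⇔ (suc (toℕ i) ≤ l)) ×
        ((arc D (P i) x ≡ true) ⇔ (l ≤ suc (toℕ i))))
lemma3 p 4≤p D (suc n) _ m≤p∸2 P pathL longest strong degree =
  let l , 1≤l , l≤m , arcs = classification in
  l , 1≤l , l≤m , λ y y∉ i →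
    subst (λ v → (arc D y v ≡ true ⇔ toℕ i < l) × (arc D v y ≡ true ⇔ l ≤ suc (toℕ i)))
          (nth-toList P (P Fin.zero) i) (arcs y y∉ (toℕ i) (s≤s⁻¹ (toℕ<n i)))
  where
  L : List (Fin p)
  L = toList P
  length-L : length L ≡ suc n
  length-L = length-toList P
  longest′ : Longest D L
  longest′ N pathN same-head same-last with last-nonempty (P Fin.zero) (toList (P ∘ Fin.suc))
  ... | b , last-L = subst (length N ≤_) (sym length-L)
                       (longest (P Fin.zero) b refl last-L N (pathN , same-head , trans same-last last-L))
  degree′ : ∀ y → y ∉ L → deg D y L ≡ suc (length L)
  degree′ y y∉ = trans (degree y y∉) (trans (+-comm (suc n) 1) (cong suc (sym length-L)))
  room : suc (suc (length L)) ≤ p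
  room = subst (λ k → suc (suc k) ≤ p) (sym length-L)
           (≤-trans (s≤s (s≤s m≤p∸2)) (≤-reflexive (trans (+-comm 2 (p ∸ 2)) (m∸n+n≡m (≤-trans (s≤s (s≤s z≤n)) 4≤p)))))
  open OutsideLongestPath D L (P Fin.zero) n length-L pathL longest′ degree′ room strong
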